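{- Let $k+1$ be an odd prime, and let $N_k$ be the set of vectors $\mathbf{v}\in(\mathbb{Z}/(k+1)\mathbb{Z})^k$ with $\mathbf{v}\neq\mathbf{0}$ and having at least one zero coordinate. Then for every $\mathbf{v}\in N_k$ there exist units $s,r\in(\mathbb{Z}/(k+1)\mathbb{Z})^\times$ such that \[s\mathbf{v}+r(1,2,\ldots,k)\in\{1,\ldots,k-1\}^k,\] where $\{1,\ldots,k-1\}$ denotes the corresponding residues modulo $k+1$. -}

module Defs where

open import Data.Nat using (ℕ; suc; _+_; _*_; _%_; _<_; _≤_; _∸_; NonZero)
open import Data.Nat.DivMod using (_mod_)
import Data.Empty
open import Data.Fin using (Fin; toℕ; fromℕ<)
open import Data.Product using (∃; _×_)
open import Data.Sum using (_⊎_)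
open import Relation.Binary.PropositionalEquality using (_≡_; _≢_)

ZMod : ℕ → Set
ZMod n = Fin n

[_]ₘ : ∀ {n} .{{_ : NonZero n}} → ℕ → ZMod n
[_]ₘ {n} a = a mod n

_+ₘ_ : ∀ {n} .{{_ : NonZero n}} → ZMod n → ZMod n → ZMod n
x +ₘ y = [ toℕ x + toℕ y ]ₘ

_*ₘ_ : ∀ {n} .{{_ : NonZero n}} → ZMod n → ZMod n → ZMod n
x *ₘ y = [ toℕ x * toℕ y ]ₘ

IsUnit : ∀ {n} .{{_ : NonZero n}} → ZMod n → Set
IsUnit {n} s = ∃ λ t → s *ₘ t ≡ [ 1 ]ₘ

ZVec : ℕ → ℕ → Set
ZVec n k = Fin k → ZMod n

IsZeroVec : ∀ {n k} → ZVec n k → Set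
IsZeroVec {n} {k} v = ∀ i → toℕ (v i) ≡ 0

InN : ∀ {n k} → ZVec n k → Set
InN {n} {k} v = (IsZeroVec v → Data.Empty.⊥) × ∃ λ (i : Fin k) → toℕ (v i) ≡ 0

-- s v + r (1, 2, ..., k); coordinate i (0-based) of (1,..,k) is i+1
combo : ∀ {n k} .{{_ : NonZero n}} → ZMod n → ZMod n → ZVec n k → ZVec n k
combo s r v i = (s *ₘ v i) +ₘ (r *ₘ [ suc (toℕ i) ]ₘ)

InRange : ∀ {n} → ℕ → ZMod n → Set
InRange k x = 1 ≤ toℕ x × toℕ x ≤ k ∸ 1

{-# OPTIONS --safe #-}
module Submission where

-- Let p = k + 1 and line t = t·v + (1, …, k), read in ℕ.  If some t ≢ 0 (mod p) makes all
-- coordinates of line t nonzero mod p while missing some nonzero residue U, then r = k·U⁻¹ ≡ −U⁻¹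
-- and s = r·t work: s·v + r·(1, …, k) ≡ r·(line t) avoids both 0 and r·U ≡ k.
-- Otherwise, for each t < p the product P(t) = ∏ᵢ line t i is ≡ 0 (a coordinate vanishes) or
-- ≡ k! (line t hits, hence permutes, the nonzero residues).  As v has a zero coordinate, P is a
-- polynomial of degree < k = p − 1, so p ∣ ∑_{t<p} P(t): in the binomial basis,
-- ∑_{t<p} C(t, j) = C(p, j + 1), which p divides for j + 1 < p.  Yet that sum is ≡ k!·D, where
-- 0 < D < p counts the t < p for which line t has no zero coordinate: t = 0 counts, and a
-- nonzero coordinate of v vanishes on line t for some t.

open import Defs
open import Data.Fin using (Fin; zero; suc; toℕ; fromℕ<; punchOut)
import Data.Fin as Fin
open import Data.Fin.Permutation using (permutation)
open import Data.Fin.Properties using (any?; all?; ¬∀⟶∃¬; toℕ<n; toℕ-fromℕ<; toℕ-injective; punchOut-injective; injective⇒≤)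
open import Data.List using (List; []; _∷_; length; map)
open import Data.List.Properties using (length-map)
open import Data.Nat
open import Data.Nat.Combinatorics using (_C_; nC1≡n; nCk+nC[k+1]≡[n+1]C[k+1])
open import Data.Nat.Coprimality using (prime⇒coprime; coprime-Bézout)
open import Data.Nat.DivMod
open import Data.Nat.Divisibility
open import Data.Nat.GCD using (module Bézout)
open import Data.Nat.Primality using (Prime; euclidsLemma; prime⇒nonTrivial)
open import Data.Nat.Properties
open import Algebra.Properties.CommutativeMonoid.Sum *-1-commutativeMonoid
  using () renaming (sum to ∏; sum-remove to ∏-remove; sum-permute to ∏-permute)
open import Data.Nat.Tactic.RingSolver using (solve-∀)
open import Data.Product using (∃; _×_; ∃-syntax; _,_; proj₁; proj₂)
open import Data.Sum using (inj₁; inj₂)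
open import Data.Vec.Functional using (removeAt)
open import Function using (_∘_)
open import Function.Definitions using (Injective)
open import Relation.Binary.Bundles using (Setoid)
open import Relation.Binary.PropositionalEquality
import Relation.Binary.Reasoning.Setoid as SetoidReasoning
open import Relation.Nullary using (¬_; Dec; yes; no; contradiction; ¬?)
open import Relation.Nullary.Decidable using (_×-dec_; map′)

pascal : ∀ n j → suc n C suc j ≡ n C j + n C suc j
pascal n j = sym (nCk+nC[k+1]≡[n+1]C[k+1] n j)

*-C : ∀ t j → t * (t C j) ≡ suc j * (t C suc j) + j * (t C j)
*-C zero    zero    = refl
*-C zero    (suc j) = sym (cong₂ _+_ (*-zeroʳ (2 + j)) (*-zeroʳ (suc j)))
*-C (suc t) zero    = trans (*-identityʳ (suc t)) (sym (trans (+-identityʳ _) (trans (+-identityʳ _) (nC1≡n (suc t)))))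
*-C (suc t) (suc j) = begin
  suc t * (suc t C suc j)                                 ≡⟨ cong (suc t *_) (pascal t j) ⟩
  suc t * (x + y)                                         ≡⟨ expand t x y ⟩
  x + y + t * x + t * y                                   ≡⟨ cong₂ (λ a b → x + y + a + b) (*-C t j) (*-C t (suc j)) ⟩
  x + y + (suc j * y + j * x) + ((2 + j) * z + suc j * y) ≡⟨ collect j x y z ⟩
  (2 + j) * (y + z) + suc j * (x + y)                     ≡⟨ cong₂ (λ a b → (2 + j) * a + suc j * b) (pascal t (suc j)) (pascal t j) ⟨
  (2 + j) * (suc t C (2 + j)) + suc j * (suc t C suc j)   ∎
  where
  open ≡-Reasoning
  x y z : ℕ
  x = t C j
  y = t C suc j
  z = t C (2 + j)
  expand : ∀ t x y → suc t * (x + y) ≡ x + y + t * x + t * y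
  expand = solve-∀
  collect : ∀ j x y z → x + y + (suc j * y + j * x) + ((2 + j) * z + suc j * y) ≡ (2 + j) * (y + z) + suc j * (x + y)
  collect = solve-∀

suc-*-C-suc : ∀ n j → suc j * (suc n C suc j) ≡ suc n * (n C j)
suc-*-C-suc n j = begin
  suc j * (suc n C suc j)     ≡⟨ cong (suc j *_) (pascal n j) ⟩
  suc j * (x + y)             ≡⟨ regroup j x y ⟩
  x + (suc j * y + j * x)     ≡⟨ cong (x +_) (*-C n j) ⟨
  suc n * x                   ∎
  where
  open ≡-Reasoning
  x y : ℕ
  x = n C j
  y = n C suc j
  regroup : ∀ j x y → suc j * (x + y) ≡ x + (suc j * y + j * x)
  regroup = solve-∀

prime∣C : ∀ {n j} → Prime (suc n) → j < n → suc n ∣ suc n C suc j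
prime∣C {n} {j} p-prime j<n
  with euclidsLemma (suc j) (suc n C suc j) p-prime (divides (n C j) (trans (suc-*-C-suc n j) (*-comm (suc n) (n C j))))
... | inj₁ p∣1+j = contradiction p∣1+j (>⇒∤ (s≤s j<n))
... | inj₂ p∣C   = p∣C

∑< : ℕ → (ℕ → ℕ) → ℕ
∑< zero    f = 0
∑< (suc n) f = ∑< n f + f n

syntax ∑< n (λ t → e) = ∑[ t < n ] e

∑<-cong : ∀ n {f g} → (∀ t → t < n → f t ≡ g t) → ∑< n f ≡ ∑< n g
∑<-cong zero    f≗g = refl
∑<-cong (suc n) f≗g = cong₂ _+_ (∑<-cong n λ t t<n → f≗g t (m<n⇒m<1+n t<n)) (f≗g n (n<1+n n))

∑<-distrib-+ : ∀ n f g → ∑[ t < n ] (f t + g t) ≡ ∑< n f + ∑< n g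
∑<-distrib-+ zero    f g = refl
∑<-distrib-+ (suc n) f g = trans (cong (_+ (f n + g n)) (∑<-distrib-+ n f g)) (interchange (∑< n f) (∑< n g) (f n) (g n))
  where
  interchange : ∀ a b c d → a + b + (c + d) ≡ a + c + (b + d)
  interchange = solve-∀

*-distribˡ-∑< : ∀ n c f → ∑[ t < n ] (c * f t) ≡ c * ∑< n f
*-distribˡ-∑< zero    c f = sym (*-zeroʳ c)
*-distribˡ-∑< (suc n) c f = trans (cong (_+ c * f n) (*-distribˡ-∑< n c f)) (sym (*-distribˡ-+ c _ _))

∑<-zero : ∀ n → ∑[ t < n ] 0 ≡ 0
∑<-zero zero    = refl
∑<-zero (suc n) = trans (+-identityʳ _) (∑<-zero n)

term≤∑< : ∀ {n t} f → t < n → f t ≤ ∑< n f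
term≤∑< {suc n} {t} f t<1+n with m<1+n⇒m<n∨m≡n t<1+n
... | inj₁ t<n  = ≤-trans (term≤∑< f t<n) (m≤m+n (∑< n f) (f n))
... | inj₂ refl = m≤n+m (f t) (∑< n f)

∑<-≤-length : ∀ n {f} → (∀ s → f s ≤ 1) → ∑< n f ≤ n
∑<-≤-length zero    f≤1 = z≤n
∑<-≤-length (suc n) {f} f≤1 = subst (∑< (suc n) f ≤_) (+-comm n 1) (+-mono-≤ (∑<-≤-length n f≤1) (f≤1 n))

∑<-<-length : ∀ {n t} f → (∀ s → f s ≤ 1) → t < n → f t ≡ 0 → ∑< n f < n
∑<-<-length {suc n} {t} f f≤1 t<1+n ft≡0 with m<1+n⇒m<n∨m≡n t<1+n
... | inj₁ t<n  = subst (∑< (suc n) f <_) (+-comm n 1) (+-mono-<-≤ (∑<-<-length f f≤1 t<n ft≡0) (f≤1 n))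
... | inj₂ refl = subst (∑< (suc n) f <_) (+-comm n 1) (+-mono-≤-< (∑<-≤-length n f≤1) (≤-reflexive (cong suc ft≡0)))

hockey-stick : ∀ n j → ∑[ t < n ] (t C j) ≡ n C suc j
hockey-stick zero    j = refl
hockey-stick (suc n) j = trans (cong (_+ n C j) (hockey-stick n j)) (trans (+-comm (n C suc j) (n C j)) (sym (pascal n j)))

-- newton j cs t = ∑ₘ cs[m] · C(t, j + m): a polynomial in t in the binomial basis.
newton : ℕ → List ℕ → ℕ → ℕ
newton j []       t = 0
newton j (c ∷ cs) t = c * (t C j) + newton (suc j) cs t

-- By *-C, (a·t + b)·C(t, j) = (a·j + b)·C(t, j) + a·(j + 1)·C(t, j + 1); e carries the second
-- term into the next coefficient.
mulLinear : (j a b e : ℕ) → List ℕ → List ℕ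
mulLinear j a b e []       = e ∷ []
mulLinear j a b e (c ∷ cs) = e + c * (a * j + b) ∷ mulLinear (suc j) a b (c * a * suc j) cs

length-mulLinear : ∀ j a b e cs → length (mulLinear j a b e cs) ≡ suc (length cs)
length-mulLinear j a b e []       = refl
length-mulLinear j a b e (c ∷ cs) = cong suc (length-mulLinear (suc j) a b (c * a * suc j) cs)

newton-mulLinear : ∀ j a b e cs t → newton j (mulLinear j a b e cs) t ≡ e * (t C j) + (a * t + b) * newton j cs t
newton-mulLinear j a b e []       t = cong (e * (t C j) +_) (sym (*-zeroʳ (a * t + b)))
newton-mulLinear j a b e (c ∷ cs) t = begin
  (e + c * (a * j + b)) * x + newton (suc j) (mulLinear (suc j) a b (c * a * suc j) cs) t
    ≡⟨ cong ((e + c * (a * j + b)) * x +_) (newton-mulLinear (suc j) a b (c * a * suc j) cs t) ⟩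
  (e + c * (a * j + b)) * x + (c * a * suc j * y + (a * t + b) * N)
    ≡⟨ regroup e c a j b x y t N ⟩
  e * x + c * a * (suc j * y + j * x) + c * b * x + (a * t + b) * N
    ≡⟨ cong (λ z → e * x + c * a * z + c * b * x + (a * t + b) * N) (*-C t j) ⟨
  e * x + c * a * (t * x) + c * b * x + (a * t + b) * N
    ≡⟨ factor e c a t b x N ⟩
  e * x + (a * t + b) * (c * x + N) ∎
  where
  open ≡-Reasoning
  x y N : ℕ
  x = t C j
  y = t C suc j
  N = newton (suc j) cs t
  regroup : ∀ e c a j b x y t N → (e + c * (a * j + b)) * x + (c * a * suc j * y + (a * t + b) * N)
                                  ≡ e * x + c * a * (suc j * y + j * x) + c * b * x + (a * t + b) * N
  regroup = solve-∀
  factor : ∀ e c a t b x N → e * x + c * a * (t * x) + c * b * x + (a * t + b) * N ≡ e * x + (a * t + b) * (c * x + N)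
  factor = solve-∀

newton-scale : ∀ j b cs t → newton j (map (b *_) cs) t ≡ b * newton j cs t
newton-scale j b []       t = sym (*-zeroʳ b)
newton-scale j b (c ∷ cs) t = trans (cong₂ _+_ (*-assoc b c _) (newton-scale (suc j) b cs t)) (sym (*-distribˡ-+ b _ _))

∑<-newton : ∀ n j cs → ∑[ t < n ] newton j cs t ≡ newton (suc j) cs n
∑<-newton n j []       = ∑<-zero n
∑<-newton n j (c ∷ cs) = begin
  ∑[ t < n ] (c * (t C j) + newton (suc j) cs t)             ≡⟨ ∑<-distrib-+ n _ _ ⟩
  ∑[ t < n ] (c * (t C j)) + ∑[ t < n ] newton (suc j) cs t  ≡⟨ cong₂ _+_ (*-distribˡ-∑< n c (_C j)) (∑<-newton n (suc j) cs) ⟩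
  c * ∑[ t < n ] (t C j) + newton (2 + j) cs n               ≡⟨ cong (λ z → c * z + newton (2 + j) cs n) (hockey-stick n j) ⟩
  c * (n C suc j) + newton (2 + j) cs n                      ∎
  where open ≡-Reasoning

prime∣newton : ∀ {k} → Prime (suc k) → ∀ j cs → j + length cs ≤ k → suc k ∣ newton (suc j) cs (suc k)
prime∣newton p-prime j []       _  = _ ∣0
prime∣newton {k} p-prime j (c ∷ cs) j+1+ℓ≤k =
  ∣m∣n⇒∣m+n (∣n⇒∣m*n c (prime∣C p-prime (m+n≤o⇒m≤o (suc j) 1+j+ℓ≤k))) (prime∣newton p-prime (suc j) cs 1+j+ℓ≤k)
  where
  1+j+ℓ≤k : suc j + length cs ≤ k
  1+j+ℓ≤k = subst (_≤ k) (+-suc j (length cs)) j+1+ℓ≤k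

HasDegree< : ℕ → (ℕ → ℕ) → Set
HasDegree< d f = ∃[ cs ] length cs ≤ d × (∀ t → f t ≡ newton 0 cs t)

hasDegree<-resp-≗ : ∀ {d f g} → (∀ t → f t ≡ g t) → HasDegree< d f → HasDegree< d g
hasDegree<-resp-≗ f≗g (cs , ℓ≤d , f≗cs) = cs , ℓ≤d , λ t → trans (sym (f≗g t)) (f≗cs t)

hasDegree<-*-linear : ∀ {d f} a b → HasDegree< d f → HasDegree< (suc d) (λ t → (a * t + b) * f t)
hasDegree<-*-linear a b (cs , ℓ≤d , f≗cs) =
  mulLinear 0 a b 0 cs , subst (_≤ _) (sym (length-mulLinear 0 a b 0 cs)) (s≤s ℓ≤d) ,
  λ t → trans (cong ((a * t + b) *_) (f≗cs t)) (sym (newton-mulLinear 0 a b 0 cs t))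

hasDegree<-scale : ∀ {d f} b → HasDegree< d f → HasDegree< d (λ t → b * f t)
hasDegree<-scale b (cs , ℓ≤d , f≗cs) =
  map (b *_) cs , subst (_≤ _) (sym (length-map (b *_) cs)) ℓ≤d ,
  λ t → trans (cong (b *_) (f≗cs t)) (sym (newton-scale 0 b cs t))

prime∣∑<-hasDegree< : ∀ {k f} → Prime (suc k) → HasDegree< k f → suc k ∣ ∑< (suc k) f
prime∣∑<-hasDegree< {k} {f} p-prime (cs , ℓ≤k , f≗cs) =
  subst (suc k ∣_) (sym (trans (∑<-cong (suc k) λ t _ → f≗cs t) (∑<-newton (suc k) 0 cs))) (prime∣newton p-prime 0 cs ℓ≤k)

∏-linear-hasDegree< : ∀ {n} (a b : Fin n → ℕ) → HasDegree< (suc n) (λ t → ∏ λ i → a i * t + b i)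
∏-linear-hasDegree< {zero}  a b = 1 ∷ [] , ≤-refl , λ t → refl
∏-linear-hasDegree< {suc n} a b = hasDegree<-*-linear (a zero) (b zero) (∏-linear-hasDegree< (a ∘ suc) (b ∘ suc))

∏-linear-hasDegree<-constant-factor : ∀ {n} (a b : Fin n → ℕ) i → a i ≡ 0 →
                                      HasDegree< n (λ t → ∏ λ j → a j * t + b j)
∏-linear-hasDegree<-constant-factor {suc n} a b i aᵢ≡0 =
  hasDegree<-resp-≗ split (hasDegree<-scale (b i) (∏-linear-hasDegree< (removeAt a i) (removeAt b i)))
  where
  split : ∀ t → b i * ∏ (removeAt (λ j → a j * t + b j) i) ≡ ∏ (λ j → a j * t + b j)
  split t = begin
    b i * ∏ (removeAt f i) ≡⟨ cong (λ x → (x * t + b i) * ∏ (removeAt f i)) aᵢ≡0 ⟨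
    f i * ∏ (removeAt f i) ≡⟨ ∏-remove f ⟨
    ∏ f                    ∎
    where
    open ≡-Reasoning
    f : Fin (suc n) → ℕ
    f j = a j * t + b j

∣∏ : ∀ {n d} (f : Fin n → ℕ) i → d ∣ f i → d ∣ ∏ f
∣∏ f zero    d∣f0 = ∣m⇒∣m*n (∏ (f ∘ suc)) d∣f0
∣∏ f (suc i) d∣fi = ∣n⇒∣m*n (f zero) (∣∏ (f ∘ suc) i d∣fi)

prime∤∏ : ∀ {n p} → Prime p → (f : Fin n → ℕ) → (∀ i → p ∤ f i) → p ∤ ∏ f
prime∤∏ {zero}  p-prime f p∤f p∣1 = nonTrivial⇒≢1 {{prime⇒nonTrivial p-prime}} (∣1⇒≡1 p∣1)
prime∤∏ {suc n} p-prime f p∤f p∣∏ with euclidsLemma (f zero) (∏ (f ∘ suc)) p-prime p∣∏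
... | inj₁ p∣f0   = p∤f zero p∣f0
... | inj₂ p∣rest = prime∤∏ p-prime (f ∘ suc) (p∤f ∘ suc) p∣rest

injective⇒surjective : ∀ {n} (g : Fin n → Fin n) → Injective _≡_ _≡_ g → ∀ u → ∃ λ i → g i ≡ u
injective⇒surjective {suc n} g g-inj u with any? (λ i → g i Fin.≟ u)
... | yes hit = hit
... | no miss = contradiction (injective⇒≤ g-punchOut-inj) (n≮n n)
  where
  g≢u : ∀ i → u ≢ g i
  g≢u i u≡gi = miss (i , sym u≡gi)
  g-punchOut : Fin (suc n) → Fin n
  g-punchOut i = punchOut (g≢u i)
  g-punchOut-inj : Injective _≡_ _≡_ g-punchOut
  g-punchOut-inj {i} {j} eq = g-inj (punchOut-injective (g≢u i) (g≢u j) eq)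

∏-reindex : ∀ {n} (h : Fin n → Fin n) → (∀ u → ∃ λ i → h i ≡ u) → ∀ g → ∏ (g ∘ h) ≡ ∏ g
∏-reindex {n} h h-surj g = sym (∏-permute g (permutation h h⁻¹ h∘h⁻¹ h⁻¹∘h))
  where
  h⁻¹ : Fin n → Fin n
  h⁻¹ = proj₁ ∘ h-surj
  h∘h⁻¹ : ∀ u → h (h⁻¹ u) ≡ u
  h∘h⁻¹ = proj₂ ∘ h-surj
  h⁻¹-inj : Injective _≡_ _≡_ h⁻¹
  h⁻¹-inj {u} {w} eq = trans (sym (h∘h⁻¹ u)) (trans (cong h eq) (h∘h⁻¹ w))
  h⁻¹∘h : ∀ i → h⁻¹ (h i) ≡ i
  h⁻¹∘h i with j , refl ← injective⇒surjective h⁻¹ h⁻¹-inj i = cong h⁻¹ (h∘h⁻¹ j)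

module Congruence (n : ℕ) .{{_ : NonZero n}} where

  -- A record rather than x % n ≡ y % n itself, so that x and y are inferable from a proof.
  infix 4 _≋_
  record _≋_ (x y : ℕ) : Set where
    constructor congruent
    field %-≡ : x % n ≡ y % n

  open _≋_ public

  ≡⇒≋ : ∀ {x y} → x ≡ y → x ≋ y
  ≡⇒≋ refl = congruent refl

  ≋-setoid : Setoid _ _
  ≋-setoid = record
    { Carrier       = ℕ
    ; _≈_           = _≋_
    ; isEquivalence = record
      { refl  = congruent refl
      ; sym   = λ x≋y → congruent (sym (%-≡ x≋y))
      ; trans = λ x≋y y≋z → congruent (trans (%-≡ x≋y) (%-≡ y≋z))
      }
    }

  open Setoid ≋-setoid public using () renaming (refl to ≋-refl; sym to ≋-sym; trans to ≋-trans)

  module ≋-Reasoning = SetoidReasoning ≋-setoid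

  _≋?_ : ∀ x y → Dec (x ≋ y)
  x ≋? y = map′ congruent %-≡ (x % n ≟ y % n)

  %-≋ : ∀ x → x % n ≋ x
  %-≋ x = congruent (m%n%n≡m%n x n)

  ≋-+ : ∀ {x y u v} → x ≋ y → u ≋ v → x + u ≋ y + v
  ≋-+ {x} {y} {u} {v} (congruent x≋y) (congruent u≋v) = congruent (begin
    (x + u) % n           ≡⟨ %-distribˡ-+ x u n ⟩
    (x % n + u % n) % n   ≡⟨ cong₂ (λ a b → (a + b) % n) x≋y u≋v ⟩
    (y % n + v % n) % n   ≡⟨ %-distribˡ-+ y v n ⟨
    (y + v) % n           ∎)
    where open ≡-Reasoning

  ≋-* : ∀ {x y u v} → x ≋ y → u ≋ v → x * u ≋ y * v
  ≋-* {x} {y} {u} {v} (congruent x≋y) (congruent u≋v) = congruent (begin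
    (x * u) % n           ≡⟨ %-distribˡ-* x u n ⟩
    (x % n * (u % n)) % n ≡⟨ cong₂ (λ a b → (a * b) % n) x≋y u≋v ⟩
    (y % n * (v % n)) % n ≡⟨ %-distribˡ-* y v n ⟨
    (y * v) % n           ∎)
    where open ≡-Reasoning

  ≋-*ˡ : ∀ c {x y} → x ≋ y → c * x ≋ c * y
  ≋-*ˡ c = ≋-* (≋-refl {c})

  ≋-*ʳ : ∀ c {x y} → x ≋ y → x * c ≋ y * c
  ≋-*ʳ c x≋y = ≋-* x≋y (≋-refl {c})

  ≋-+ʳ : ∀ c {x y} → x ≋ y → x + c ≋ y + c
  ≋-+ʳ c x≋y = ≋-+ x≋y (≋-refl {c})

  +-multiple-≋ : ∀ x {m} → n ∣ m → x + m ≋ x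
  +-multiple-≋ x n∣m = congruent (%-remove-+ʳ x n∣m)

  ≋-<⇒≡ : ∀ {x y} → x < n → y < n → x ≋ y → x ≡ y
  ≋-<⇒≡ x<n y<n (congruent x≋y) = trans (sym (m<n⇒m%n≡m x<n)) (trans x≋y (m<n⇒m%n≡m y<n))

  0%n≡0 : 0 % n ≡ 0
  0%n≡0 = m<n⇒m%n≡m (>-nonZero⁻¹ n)

  ∣⇒≋0 : ∀ {x} → n ∣ x → x ≋ 0
  ∣⇒≋0 {x} n∣x = congruent (trans (n∣m⇒m%n≡0 x n n∣x) (sym 0%n≡0))

  ≋0⇒∣ : ∀ {x} → x ≋ 0 → n ∣ x
  ≋0⇒∣ {x} (congruent x≋0) = m%n≡0⇒n∣m x n (trans x≋0 0%n≡0)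

  ∑<-cong-≋ : ∀ m {f g} → (∀ t → t < m → f t ≋ g t) → ∑< m f ≋ ∑< m g
  ∑<-cong-≋ zero    f≋g = ≋-refl
  ∑<-cong-≋ (suc m) f≋g = ≋-+ (∑<-cong-≋ m λ t t<m → f≋g t (m<n⇒m<1+n t<m)) (f≋g m (n<1+n m))

  ∏-cong-≋ : ∀ {m} {f g : Fin m → ℕ} → (∀ i → f i ≋ g i) → ∏ f ≋ ∏ g
  ∏-cong-≋ {zero}  f≋g = ≋-refl
  ∏-cong-≋ {suc m} f≋g = ≋-* (f≋g zero) (∏-cong-≋ (f≋g ∘ suc))

  toℕ-[]ₘ : ∀ a → toℕ ([_]ₘ {n} a) ≡ a % n
  toℕ-[]ₘ a = toℕ-fromℕ< (m%n<n a n)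

  toℕ-[]ₘ-≋ : ∀ a → toℕ ([_]ₘ {n} a) ≋ a
  toℕ-[]ₘ-≋ a = ≋-trans (≡⇒≋ (toℕ-[]ₘ a)) (%-≋ a)

  combo-≋ : ∀ {k} r t (v : ZVec n k) i → toℕ (combo [ r * t ]ₘ [ r ]ₘ v i) ≋ r * (toℕ (v i) * t + suc (toℕ i))
  combo-≋ r t v i = begin
    toℕ (combo [ r * t ]ₘ [ r ]ₘ v i)                   ≈⟨ toℕ-[]ₘ-≋ _ ⟩
    toℕ ([ r * t ]ₘ *ₘ v i) + toℕ ([ r ]ₘ *ₘ [ c ]ₘ)  ≈⟨ ≋-+ (toℕ-[]ₘ-≋ _) (toℕ-[]ₘ-≋ _) ⟩
    toℕ ([_]ₘ {n} (r * t)) * a + toℕ ([_]ₘ {n} r) * toℕ ([_]ₘ {n} c)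
                                                        ≈⟨ ≋-+ (≋-*ʳ a (toℕ-[]ₘ-≋ (r * t))) (≋-* (toℕ-[]ₘ-≋ r) (toℕ-[]ₘ-≋ c)) ⟩
    r * t * a + r * c                                   ≡⟨ factor r t a c ⟩
    r * (a * t + c)                                     ∎
    where
    open ≋-Reasoning
    a c : ℕ
    a = toℕ (v i)
    c = suc (toℕ i)
    factor : ∀ r t a c → r * t * a + r * c ≡ r * (a * t + c)
    factor = solve-∀

module _ {k} (p-prime : Prime (suc k)) where
  open Congruence (suc k)

  ∤-* : ∀ {x y} → suc k ∤ x → suc k ∤ y → suc k ∤ x * y
  ∤-* {x} {y} p∤x p∤y p∣xy with euclidsLemma x y p-prime p∣xy
  ... | inj₁ p∣x = p∤x p∣x
  ... | inj₂ p∣y = p∤y p∣y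

  ≋-inverse : ∀ {a} → suc k ∤ a → ∃ λ b → a * b ≋ 1
  ≋-inverse {a} p∤a with coprime-Bézout (prime⇒coprime p-prime {{≢-nonZero (p∤a ∘ m%n≡0⇒n∣m a (suc k))}} (m%n<n a (suc k)))
  ... | Bézout.-+ x y 1+xp≡ya% = y , (begin
    a * y            ≈⟨ ≋-*ʳ y (%-≋ a) ⟨
    a % suc k * y    ≡⟨ *-comm (a % suc k) y ⟩
    y * (a % suc k)  ≡⟨ 1+xp≡ya% ⟨
    1 + x * suc k    ≈⟨ +-multiple-≋ 1 (n∣m*n x) ⟩
    1                ∎)
    where open ≋-Reasoning
  ... | Bézout.+- x y 1+ya%≡xp = k * y , (begin
    a * (k * y)          ≈⟨ ≋-*ʳ (k * y) (%-≋ a) ⟨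
    a % suc k * (k * y)  ≡⟨ rearrange (a % suc k) k y ⟩
    k * z + 0            ≈⟨ ≋-+ (≋-refl {k * z}) (∣⇒≋0 (divides x 1+ya%≡xp)) ⟨
    k * z + (1 + z)      ≡⟨ collect k z ⟩
    1 + z * suc k        ≈⟨ +-multiple-≋ 1 (n∣m*n z) ⟩
    1                    ∎)
    where
    open ≋-Reasoning
    z : ℕ
    z = y * (a % suc k)
    rearrange : ∀ a k y → a * (k * y) ≡ k * (y * a) + 0
    rearrange = solve-∀
    collect : ∀ k z → k * z + (1 + z) ≡ 1 + z * suc k
    collect = solve-∀

  ≋-cancelˡ : ∀ {a x y} → suc k ∤ a → a * x ≋ a * y → x ≋ y
  ≋-cancelˡ {a} {x} {y} p∤a ax≋ay with b , ab≋1 ← ≋-inverse p∤a = begin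
    x              ≡⟨ *-identityˡ x ⟨
    1 * x          ≈⟨ ≋-*ʳ x ab≋1 ⟨
    a * b * x      ≡⟨ *-comm-assoc a b x ⟩
    b * (a * x)    ≈⟨ ≋-*ˡ b ax≋ay ⟩
    b * (a * y)    ≡⟨ *-comm-assoc a b y ⟨
    a * b * y      ≈⟨ ≋-*ʳ y ab≋1 ⟩
    1 * y          ≡⟨ *-identityˡ y ⟩
    y              ∎
    where
    open ≋-Reasoning
    *-comm-assoc : ∀ a b x → a * b * x ≡ b * (a * x)
    *-comm-assoc = solve-∀

  linear-root : ∀ {a} → suc k ∤ a → ∀ c → ∃ λ t → t < suc k × suc k ∣ a * t + c
  linear-root {a} p∤a c with b , ab≋1 ← ≋-inverse p∤a = t , m%n<n (k * c * b) (suc k) , ≋0⇒∣ (begin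
    a * t + c                ≈⟨ ≋-+ʳ c (≋-*ˡ a (%-≋ (k * c * b))) ⟩
    a * (k * c * b) + c      ≡⟨ rearrange a k c b ⟩
    k * c * (a * b) + c      ≈⟨ ≋-+ʳ c (≋-*ˡ (k * c) ab≋1) ⟩
    k * c * 1 + c            ≡⟨ collect k c ⟩
    c * suc k                ≈⟨ ∣⇒≋0 (n∣m*n c) ⟩
    0                        ∎)
    where
    open ≋-Reasoning
    t : ℕ
    t = k * c * b % suc k
    rearrange : ∀ a k c b → a * (k * c * b) + c ≡ k * c * (a * b) + c
    rearrange = solve-∀
    collect : ∀ k c → k * c * 1 + c ≡ c * suc k
    collect = solve-∀

  isUnit-[]ₘ : ∀ {m} → suc k ∤ m → IsUnit ([_]ₘ {suc k} m)
  isUnit-[]ₘ {m} p∤m with b , mb≋1 ← ≋-inverse p∤m =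
    [ b ]ₘ , toℕ-injective (begin
      toℕ ([ m ]ₘ *ₘ [ b ]ₘ)  ≡⟨ toℕ-[]ₘ (toℕ [ m ]ₘ * toℕ [ b ]ₘ) ⟩
      toℕ [ m ]ₘ * toℕ [ b ]ₘ % suc k ≡⟨ %-≡ (≋-trans (≋-* (toℕ-[]ₘ-≋ m) (toℕ-[]ₘ-≋ b)) mb≋1) ⟩
      1 % suc k               ≡⟨ toℕ-[]ₘ 1 ⟨
      toℕ [ 1 ]ₘ              ∎)
    where open ≡-Reasoning

InRange-intro : ∀ {k} (x : Fin (suc k)) → toℕ x ≢ 0 → toℕ x ≢ k → InRange k x
InRange-intro x x≢0 x≢k = n≢0⇒n>0 x≢0 , <⇒≤pred (≤∧≢⇒< (s≤s⁻¹ (toℕ<n x)) x≢k)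

module _ {k : ℕ} where
  open Congruence (suc k)

  nonzero-residue : ∀ m → suc k ∤ m → ∃ λ (u : Fin k) → m ≋ suc (toℕ u)
  nonzero-residue m p∤m with m mod suc k in eq
  ... | zero  = contradiction (≋0⇒∣ (≋-trans (≋-sym (toℕ-[]ₘ-≋ m)) (≡⇒≋ (cong toℕ eq)))) p∤m
  ... | suc u = u , ≋-trans (≋-sym (toℕ-[]ₘ-≋ m)) (≡⇒≋ (cong toℕ eq))

  ∏-covering-nonzero-residues : (g : Fin k → ℕ) → (∀ i → suc k ∤ g i) → (∀ u → ∃ λ i → g i ≋ suc (toℕ u)) →
                                ∏ g ≋ ∏ {k} (suc ∘ toℕ)
  ∏-covering-nonzero-residues g p∤g covers = begin
    ∏ g                   ≈⟨ ∏-cong-≋ (proj₂ ∘ residue) ⟩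
    ∏ (suc ∘ toℕ ∘ h)     ≡⟨ ∏-reindex h h-surj (suc ∘ toℕ) ⟩
    ∏ {k} (suc ∘ toℕ)     ∎
    where
    open ≋-Reasoning
    residue : ∀ i → ∃ λ u → g i ≋ suc (toℕ u)
    residue i = nonzero-residue (g i) (p∤g i)
    h : Fin k → Fin k
    h = proj₁ ∘ residue
    h-surj : ∀ u → ∃ λ i → h i ≡ u
    h-surj u with i , gᵢ≋u ← covers u =
      i , toℕ-injective (suc-injective (≋-<⇒≡ (s≤s (toℕ<n (h i))) (s≤s (toℕ<n u)) (≋-trans (≋-sym (proj₂ (residue i))) gᵢ≋u)))

module _ {k : ℕ} (p-prime : Prime (suc k)) (v : ZVec (suc k) k) where
  open Congruence (suc k)

  k! : ℕ
  k! = ∏ {k} (suc ∘ toℕ)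

  line : ℕ → Fin k → ℕ
  line t i = toℕ (v i) * t + suc (toℕ i)

  Avoids : ℕ → Fin k → Set
  Avoids t u = (∀ i → suc k ∤ line t i) × (∀ i → ¬ line t i ≋ suc (toℕ u))

  avoids? : ∀ t u → Dec (Avoids t u)
  avoids? t u = all? (λ i → ¬? (suc k ∣? line t i)) ×-dec all? (λ i → ¬? (line t i ≋? suc (toℕ u)))

  solution : ∀ {t} u → suc k ∤ t → Avoids t u →
             ∃[ s ] ∃[ r ] (IsUnit s × IsUnit r × (∀ i → InRange k (combo s r v i)))
  solution {t} u p∤t (zero-free , misses) with b , Ub≋1 ← ≋-inverse p-prime (>⇒∤ (s≤s (toℕ<n u))) =
    [ r * t ]ₘ , [ r ]ₘ , isUnit-[]ₘ p-prime (∤-* p-prime p∤r p∤t) , isUnit-[]ₘ p-prime p∤r , in-range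
    where
    U r : ℕ
    U = suc (toℕ u)
    r = k * b
    rU≋k : r * U ≋ k
    rU≋k = begin
      k * b * U    ≡⟨ *-assoc-comm k b U ⟩
      k * (U * b)  ≈⟨ ≋-*ˡ k Ub≋1 ⟩
      k * 1        ≡⟨ *-identityʳ k ⟩
      k            ∎
      where
      open ≋-Reasoning
      *-assoc-comm : ∀ k b U → k * b * U ≡ k * (U * b)
      *-assoc-comm = solve-∀
    p∤k : suc k ∤ k
    p∤k = >⇒∤ {{>-nonZero (s≤s⁻¹ (nonTrivial⇒n>1 (suc k) {{prime⇒nonTrivial p-prime}}))}} (n<1+n k)
    p∤r : suc k ∤ r
    p∤r p∣r = p∤k (≋0⇒∣ (≋-trans (≋-sym rU≋k) (≋-*ʳ U (∣⇒≋0 p∣r))))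
    in-range : ∀ i → InRange k (combo [ r * t ]ₘ [ r ]ₘ v i)
    in-range i = InRange-intro (combo [ r * t ]ₘ [ r ]ₘ v i) X≢0 X≢k
      where
      X≋ : toℕ (combo [ r * t ]ₘ [ r ]ₘ v i) ≋ r * line t i
      X≋ = combo-≋ r t v i
      X≢0 : toℕ (combo [ r * t ]ₘ [ r ]ₘ v i) ≢ 0
      X≢0 X≡0 = ∤-* p-prime p∤r (zero-free i) (≋0⇒∣ (≋-trans (≋-sym X≋) (≡⇒≋ X≡0)))
      X≢k : toℕ (combo [ r * t ]ₘ [ r ]ₘ v i) ≢ k
      X≢k X≡k = misses i (≋-cancelˡ p-prime p∤r (≋-trans (≋-sym X≋) (≋-trans (≡⇒≋ X≡k) (≋-sym rU≋k))))

  zeroFree : ℕ → ℕ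
  zeroFree t with any? (λ i → suc k ∣? line t i)
  ... | yes _ = 0
  ... | no  _ = 1

  zeroFree≤1 : ∀ t → zeroFree t ≤ 1
  zeroFree≤1 t with any? (λ i → suc k ∣? line t i)
  ... | yes _ = z≤n
  ... | no  _ = ≤-refl

  zeroFree-vanishes : ∀ {t} i → suc k ∣ line t i → zeroFree t ≡ 0
  zeroFree-vanishes {t} i p∣line with any? (λ i → suc k ∣? line t i)
  ... | yes _    = refl
  ... | no  none = contradiction (i , p∣line) none

  line-0 : ∀ i → line 0 i ≡ suc (toℕ i)
  line-0 i = cong (_+ suc (toℕ i)) (*-zeroʳ (toℕ (v i)))

  zeroFree-0 : zeroFree 0 ≡ 1
  zeroFree-0 with any? (λ i → suc k ∣? line 0 i)
  ... | yes (i , p∣line) = contradiction (subst (suc k ∣_) (line-0 i) p∣line) (>⇒∤ (s≤s (toℕ<n i)))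
  ... | no  _            = refl

  module _ (every-line-hits : ∀ {t} u → 0 < t → t < suc k → ¬ Avoids t u) where

    ∏-zero-free-line : ∀ {t} → t < suc k → (∀ i → suc k ∤ line t i) → ∏ (line t) ≋ k!
    ∏-zero-free-line {zero}  _   _         = ∏-cong-≋ (≡⇒≋ ∘ line-0)
    ∏-zero-free-line {suc t} t<p zero-free = ∏-covering-nonzero-residues (line (suc t)) zero-free covers
      where
      covers : ∀ u → ∃ λ i → line (suc t) i ≋ suc (toℕ u)
      covers u with any? (λ i → line (suc t) i ≋? suc (toℕ u))
      ... | yes hit  = hit
      ... | no  miss = contradiction (zero-free , λ i hit → miss (i , hit)) (every-line-hits u z<s t<p)

    ∏-line≋ : ∀ {t} → t < suc k → ∏ (line t) ≋ k! * zeroFree t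
    ∏-line≋ {t} t<p with any? (λ i → suc k ∣? line t i)
    ... | yes (i , p∣line) = ≋-trans (∣⇒≋0 (∣∏ (line t) i p∣line)) (≡⇒≋ (sym (*-zeroʳ k!)))
    ... | no  no-zero      = ≋-trans (∏-zero-free-line t<p λ i p∣line → no-zero (i , p∣line)) (≡⇒≋ (sym (*-identityʳ k!)))

    ∑∏-line≋ : ∑[ t < suc k ] ∏ (line t) ≋ k! * ∑< (suc k) zeroFree
    ∑∏-line≋ = ≋-trans (∑<-cong-≋ (suc k) λ t t<p → ∏-line≋ t<p) (≡⇒≋ (*-distribˡ-∑< (suc k) k! zeroFree))

  p∣∑∏-line : ∀ {i} → toℕ (v i) ≡ 0 → suc k ∣ ∑[ t < suc k ] ∏ (line t)
  p∣∑∏-line {i} vᵢ≡0 = prime∣∑<-hasDegree< p-prime (∏-linear-hasDegree<-constant-factor (toℕ ∘ v) (suc ∘ toℕ) i vᵢ≡0)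

  p∤∑zeroFree : ∀ {i} → suc k ∤ toℕ (v i) → suc k ∤ ∑< (suc k) zeroFree
  p∤∑zeroFree {i} p∤vᵢ =
    let t₀ , t₀<p , p∣line = linear-root p-prime p∤vᵢ (suc (toℕ i))
        0<∑ : 0 < ∑< (suc k) zeroFree
        0<∑ = subst (_≤ ∑< (suc k) zeroFree) zeroFree-0 (term≤∑< zeroFree z<s)
    in >⇒∤ {{>-nonZero 0<∑}} (∑<-<-length zeroFree zeroFree≤1 t₀<p (zeroFree-vanishes i p∣line))

  avoiding-line : (∃ λ i → toℕ (v i) ≡ 0) → (∃ λ i → suc k ∤ toℕ (v i)) → ∃ λ t → ∃ λ u → suc k ∤ t × Avoids t u
  avoiding-line (_ , vᵢ₀≡0) (_ , p∤vᵢ₁) with any? (λ t → any? (λ u → avoids? (suc (toℕ t)) u))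
  ... | yes (t , u , avoids) = suc (toℕ t) , u , >⇒∤ (s≤s (toℕ<n t)) , avoids
  ... | no  none             = contradiction p∣k!*D (∤-* p-prime p∤k! (p∤∑zeroFree p∤vᵢ₁))
    where
    every-line-hits : ∀ {t} u → 0 < t → t < suc k → ¬ Avoids t u
    every-line-hits {suc t} u _ t<p avoids =
      none (fromℕ< (s≤s⁻¹ t<p) , u , subst (λ t → Avoids (suc t) u) (sym (toℕ-fromℕ< (s≤s⁻¹ t<p))) avoids)
    p∤k! : suc k ∤ k!
    p∤k! = prime∤∏ p-prime (suc ∘ toℕ) λ i → >⇒∤ (s≤s (toℕ<n i))
    p∣k!*D : suc k ∣ k! * ∑< (suc k) zeroFree
    p∣k!*D = ≋0⇒∣ (≋-trans (≋-sym (∑∏-line≋ every-line-hits)) (∣⇒≋0 (p∣∑∏-line vᵢ₀≡0)))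

nonzero-coordinate : ∀ {k} (v : ZVec (suc k) k) → ¬ IsZeroVec v → ∃ λ i → suc k ∤ toℕ (v i)
nonzero-coordinate {k} v v≢0 with i , vᵢ≢0 ← ¬∀⟶∃¬ k _ (λ i → toℕ (v i) ≟ 0) v≢0 =
  i , >⇒∤ {{≢-nonZero vᵢ≢0}} (toℕ<n (v i))

proposition14 : (k : ℕ) → Prime (suc k) → 2 ≤ k → (v : ZVec (suc k) k) → InN v →
    ∃[ s ] ∃[ r ] (IsUnit s × IsUnit r × (∀ (i : Fin k) → InRange k (combo s r v i)))
proposition14 k p-prime _ v (v≢0 , zero-coordinate) =
  let t , u , p∤t , avoids = avoiding-line p-prime v zero-coordinate (nonzero-coordinate v v≢0)
  in solution p-prime v u p∤t avoids
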